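{- Let $\mu=(\mu_1,\dots,\mu_k)\vdash n$ and $a=(a_1,\dots,a_h)\vDash n$, and assume $\mu\unrhd\lambda(a)$. Let $r$ be an integer with $1\le r\le k$. Then there exists a tableau $T\in\mathrm{STab}(\mu,a)$ with $T(r,\mu_r)=h$ if and only if $r\in R(\mu,a)$.
   Context: A composition of $n$ is a sequence $a=(a_1,\dots,a_h)$ of positive integers summing to $n$ ($a\vDash n$). A partition $\mu\vdash n$ is a non-increasing composition; $\mu_i=0$ beyond its number of parts, and trailing zeros are deleted. For compositions $a=(a_1,\dots,a_h)$, $b=(b_1,\dots,b_k)$ of $n$, $a\unrhd b$ means $k\ge h$ and $\sum_{i=1}^j a_i\ge \sum_{i=1}^j b_i$ for $j=1,\dots,h$. $\lambda(a)$ is the non-increasing rearrangement of $a$. $\mu^{(i)}$ is $\mu$ with its $i$-th entry decreased by $1$. $\tilde a=(a_1,\dots,a_{h-1},a_h-1)$ if $a_h\ge2$, and $\tilde a=(a_1,\dots,a_{h-1})$ if $a_h=1$. $D_\mu=\{(i,j):1\le i\le k,1\le j\le\mu_i\}$; $\mathrm{STab}(\mu,a)$ is the set of maps $T:D_\mu\to\{1,\dots,h\}$ with $T(i,j)\le T(i,j+1)$, $T(i,j)<T(i+1,j)$ and $|T^{ -1}(\{i\})|=a_i$ for all $i$. $R(\mu,a)$ is the set of $i\in\{1,\dots,k\}$ with $\mu_i>\mu_{i+1}$ and $\mu^{(i)}\unrhd\lambda(\tilde a)$. -}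

module Defs where

open import Data.Nat using (ℕ; zero; suc; _+_; _∸_; _≤_; _<_; _≤ᵇ_)
open import Data.Nat.Properties using (_≟_)
open import Data.Bool using (Bool; true; false; if_then_else_)
open import Data.List using (List; []; _∷_; length; take)
open import Data.Nat.ListAction using (sum)
open import Data.Product using (_×_)
open import Relation.Nullary.Decidable using (⌊_⌋)
open import Relation.Binary.PropositionalEquality using (_≡_)

-- i-th entry of a list, 1-based; 0 outside the range (so μ_i = 0 beyond its parts)
ent : List ℕ → ℕ → ℕ
ent []      _             = 0
ent (x ∷ l) zero          = 0
ent (x ∷ l) (suc zero)    = x
ent (x ∷ l) (suc (suc i)) = ent l (suc i)

data AllPos : List ℕ → Set where
  []  : AllPos []
  _∷_ : ∀ {x l} → 1 ≤ x → AllPos l → AllPos (x ∷ l)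

IsComposition : List ℕ → Set
IsComposition = AllPos

data NonIncr : List ℕ → Set where
  []   : NonIncr []
  [_]  : ∀ x → NonIncr (x ∷ [])
  cons : ∀ {x y l} → y ≤ x → NonIncr (y ∷ l) → NonIncr (x ∷ y ∷ l)

IsPartition : List ℕ → Set
IsPartition μ = AllPos μ × NonIncr μ

_⊵_ : List ℕ → List ℕ → Set
a ⊵ b = (length a ≤ length b) × (∀ j → 1 ≤ j → j ≤ length a → sum (take j b) ≤ sum (take j a))

-- λ(a): non-increasing rearrangement (insertion sort, descending)
insertDesc : ℕ → List ℕ → List ℕ
insertDesc x []      = x ∷ []
insertDesc x (y ∷ l) = if y ≤ᵇ x then x ∷ y ∷ l else y ∷ insertDesc x l

sortDesc : List ℕ → List ℕ
sortDesc []      = []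
sortDesc (x ∷ l) = insertDesc x (sortDesc l)

decAt : List ℕ → ℕ → List ℕ
decAt []      _             = []
decAt (x ∷ l) zero          = x ∷ l
decAt (x ∷ l) (suc zero)    = (x ∸ 1) ∷ l
decAt (x ∷ l) (suc (suc i)) = x ∷ decAt l (suc i)

consNZ : ℕ → List ℕ → List ℕ
consNZ zero    [] = []
consNZ (suc x) [] = suc x ∷ []
consNZ x (y ∷ l)  = x ∷ y ∷ l

stripZeros : List ℕ → List ℕ
stripZeros []      = []
stripZeros (x ∷ l) = consNZ x (stripZeros l)

-- ã : last entry decreased by 1 (and removed if it was 1)
tildeC : List ℕ → List ℕ
tildeC []                   = []
tildeC (zero ∷ [])          = []
tildeC (suc zero ∷ [])      = []
tildeC (suc (suc x) ∷ [])   = suc x ∷ []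
tildeC (x ∷ y ∷ l)          = x ∷ tildeC (y ∷ l)

μdec : List ℕ → ℕ → List ℕ
μdec μ i = stripZeros (decAt μ i)

indic : ℕ → ℕ → ℕ
indic x v = if ⌊ x ≟ v ⌋ then 1 else 0

sumTo : ℕ → (ℕ → ℕ) → ℕ
sumTo zero    f = 0
sumTo (suc m) f = sumTo m f + f (suc m)

countVal : List ℕ → (ℕ → ℕ → ℕ) → ℕ → ℕ
countVal μ T v = sumTo (length μ) (λ i → sumTo (ent μ i) (λ j → indic (T i j) v))

InD : List ℕ → ℕ → ℕ → Set
InD μ i j = (1 ≤ i) × (i ≤ length μ) × (1 ≤ j) × (j ≤ ent μ i)

-- T ∈ STab(μ, a): a map on D_μ (given as a function ℕ → ℕ → ℕ; only values on D_μ matter)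
record IsSTab (μ a : List ℕ) (T : ℕ → ℕ → ℕ) : Set where
  field
    range  : ∀ i j → InD μ i j → (1 ≤ T i j) × (T i j ≤ length a)
    rowWk  : ∀ i j → InD μ i j → InD μ i (suc j) → T i j ≤ T i (suc j)
    colStr : ∀ i j → InD μ i j → InD μ (suc i) j → T i j < T (suc i) j
    counts : ∀ v → 1 ≤ v → v ≤ length a → countVal μ T v ≡ ent a v


InR : List ℕ → List ℕ → ℕ → Set
InR μ a i = (1 ≤ i) × (i ≤ length μ) × (ent μ (suc i) < ent μ i) × (μdec μ i ⊵ sortDesc (tildeC a))

-- Removing the entries h from a semistandard tableau of content a leaves a tableau of content
-- (a_1, …, a_{h-1}) on a shape ρ such that μ ∖ ρ is a horizontal strip of size a_h, and conversely
-- every such strip can be filled with h.  Since prefix sums of a horizontal strip are controlled by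
-- the row lengths, iterating this gives the criterion: a tableau of shape μ and content a exists
-- iff the prefix sums of λ(a) never exceed those of μ.
--
-- If T(r, μ_r) = h, the cell (r, μ_r) is a corner and lies in the strip; deleting it leaves a
-- horizontal strip of μ^(r) of size a_h − 1, whence μ^(r) ⊵ λ(ã).  Conversely, when r is a corner
-- and μ^(r) ⊵ λ(ã), a strip of size a_h can be chosen to contain (r, μ_r) while the remaining shape
-- still dominates λ(a_1, …, a_{h-1}): take as few strip cells as possible in every prefix of rows,
-- but at least one in rows 1, …, j once j ≥ r.

module Submission where

open import Defs
open import Data.Bool using (true; false)
open import Data.Empty using (⊥; ⊥-elim)
open import Data.List using (List; []; _∷_; length; take; _++_)
open import Data.List.Properties using (take-all)
open import Data.Nat
open import Data.Nat.ListAction using (sum)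
open import Data.Nat.Properties
open import Data.Nat.Tactic.RingSolver using (solve-∀)
open import Data.Product using (_×_; _,_; proj₁; proj₂; ∃)
open import Data.Sum using (inj₁; inj₂)
open import Function.Bundles using (_⇔_; mk⇔; Equivalence)
open import Relation.Binary.Definitions using (tri<; tri≈; tri>)
open import Relation.Binary.PropositionalEquality
open import Relation.Nullary using (Dec; yes; no; contradiction)
open import Relation.Nullary.Reflects using (ofʸ; ofⁿ)

sumTo-cong : ∀ n {f g : ℕ → ℕ} → (∀ i → 1 ≤ i → i ≤ n → f i ≡ g i) → sumTo n f ≡ sumTo n g
sumTo-cong zero    f≡g = refl
sumTo-cong (suc n) f≡g =
  cong₂ _+_ (sumTo-cong n (λ i 1≤i i≤n → f≡g i 1≤i (m≤n⇒m≤1+n i≤n))) (f≡g (suc n) (s≤s z≤n) ≤-refl)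

sumTo-mono : ∀ n {f g : ℕ → ℕ} → (∀ i → 1 ≤ i → i ≤ n → f i ≤ g i) → sumTo n f ≤ sumTo n g
sumTo-mono zero    f≤g = z≤n
sumTo-mono (suc n) f≤g =
  +-mono-≤ (sumTo-mono n (λ i 1≤i i≤n → f≤g i 1≤i (m≤n⇒m≤1+n i≤n))) (f≤g (suc n) (s≤s z≤n) ≤-refl)

sumTo-monoˡ : ∀ (f : ℕ → ℕ) {j j′} → j ≤ j′ → sumTo j f ≤ sumTo j′ f
sumTo-monoˡ f {j} j≤j′ = go (≤⇒≤′ j≤j′)
  where
  go : ∀ {m} → j ≤′ m → sumTo j f ≤ sumTo m f
  go ≤′-refl       = ≤-refl
  go (≤′-step j≤m) = ≤-trans (go j≤m) (m≤m+n _ _)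

sumTo-vanishing : ∀ {k} (f : ℕ → ℕ) → (∀ i → k < i → f i ≡ 0) → ∀ {j} → k ≤ j → sumTo j f ≡ sumTo k f
sumTo-vanishing {k} f f≡0 k≤j = go (≤⇒≤′ k≤j)
  where
  go : ∀ {m} → k ≤′ m → sumTo m f ≡ sumTo k f
  go ≤′-refl             = refl
  go (≤′-step {m} k≤m) =
    trans (cong (sumTo m f +_) (f≡0 (suc m) (s≤s (≤′⇒≤ k≤m)))) (trans (+-identityʳ _) (go k≤m))

sumTo-+ : ∀ n (f g : ℕ → ℕ) → sumTo n (λ i → f i + g i) ≡ sumTo n f + sumTo n g
sumTo-+ zero    f g = refl
sumTo-+ (suc n) f g =
  trans (cong (_+ (f (suc n) + g (suc n))) (sumTo-+ n f g)) (interchange (sumTo n f) (sumTo n g) (f (suc n)) (g (suc n)))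
  where
  interchange : ∀ a b c d → a + b + (c + d) ≡ a + c + (b + d)
  interchange = solve-∀

sumTo-∸ : ∀ k (f ρ : ℕ → ℕ) → (∀ i → 1 ≤ i → i ≤ k → ρ i ≤ f i) →
          sumTo k ρ + sumTo k (λ i → f i ∸ ρ i) ≡ sumTo k f
sumTo-∸ k f ρ ρ≤f =
  trans (sym (sumTo-+ k ρ (λ i → f i ∸ ρ i))) (sumTo-cong k (λ i 1≤i i≤k → m+[n∸m]≡n (ρ≤f i 1≤i i≤k)))

sumTo≡0⇒≡0 : ∀ k (f : ℕ → ℕ) → sumTo k f ≡ 0 → ∀ i → 1 ≤ i → i ≤ k → f i ≡ 0
sumTo≡0⇒≡0 zero    f _ i 1≤i i≤0 = ⊥-elim (<⇒≱ 1≤i i≤0)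
sumTo≡0⇒≡0 (suc k) f Σ≡0 i 1≤i i≤k with i ≟ suc k
... | yes refl = m+n≡0⇒n≡0 (sumTo k f) Σ≡0
... | no i≢k   = sumTo≡0⇒≡0 k f (m+n≡0⇒m≡0 (sumTo k f) Σ≡0) i 1≤i (≤-pred (≤∧≢⇒< i≤k i≢k))

sumTo-ent-cons : ∀ j y s → sumTo (suc j) (ent (y ∷ s)) ≡ y + sumTo j (ent s)
sumTo-ent-cons zero    y s = +-comm 0 y
sumTo-ent-cons (suc j) y s = trans (cong (_+ ent s (suc j)) (sumTo-ent-cons j y s)) (+-assoc y _ _)

sumTo-ent-[] : ∀ j → sumTo j (ent []) ≡ 0
sumTo-ent-[] zero    = refl
sumTo-ent-[] (suc j) = trans (+-identityʳ _) (sumTo-ent-[] j)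

sum-take≡sumTo-ent : ∀ j l → sum (take j l) ≡ sumTo j (ent l)
sum-take≡sumTo-ent zero    l       = refl
sum-take≡sumTo-ent (suc j) []      = sym (sumTo-ent-[] (suc j))
sum-take≡sumTo-ent (suc j) (y ∷ s) = trans (cong (y +_) (sum-take≡sumTo-ent j s)) (sym (sumTo-ent-cons j y s))

sum≡sumTo-ent : ∀ l N → length l ≤ N → sum l ≡ sumTo N (ent l)
sum≡sumTo-ent l N |l|≤N = trans (cong sum (sym (take-all N l |l|≤N))) (sum-take≡sumTo-ent N l)

sum-take≤sum : ∀ j l → sum (take j l) ≤ sum l
sum-take≤sum zero    l       = z≤n
sum-take≤sum (suc j) []      = z≤n
sum-take≤sum (suc j) (y ∷ s) = +-monoʳ-≤ y (sum-take≤sum j s)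

take-suc≡snoc : ∀ n a → suc n ≤ length a → take (suc n) a ≡ take n a ++ ent a (suc n) ∷ []
take-suc≡snoc zero    (x ∷ a) _           = refl
take-suc≡snoc (suc n) (x ∷ a) (s≤s n<|a|) = cong (x ∷_) (take-suc≡snoc n a n<|a|)

ent-positive : ∀ l i → AllPos l → 1 ≤ i → i ≤ length l → 1 ≤ ent l i
ent-positive (x ∷ l) (suc zero)    (x>0 ∷ _)  _ _           = x>0
ent-positive (x ∷ l) (suc (suc i)) (_ ∷ l>0) _ (s≤s i<|l|) = ent-positive l (suc i) l>0 (s≤s z≤n) i<|l|

ent-beyond : ∀ l i → length l < i → ent l i ≡ 0
ent-beyond []      i             _           = refl
ent-beyond (x ∷ l) (suc (suc i)) (s≤s |l|<i) = ent-beyond l (suc i) |l|<i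

ent-nonIncr : ∀ {l} → NonIncr l → ∀ i → 1 ≤ i → ent l (suc i) ≤ ent l i
ent-nonIncr []             i             _ = z≤n
ent-nonIncr [ x ]          (suc zero)    _ = z≤n
ent-nonIncr [ x ]          (suc (suc i)) _ = z≤n
ent-nonIncr (cons y≤x l↓)  (suc zero)    _ = y≤x
ent-nonIncr (cons y≤x l↓)  (suc (suc i)) _ = ent-nonIncr l↓ (suc i) (s≤s z≤n)

NonIncr-tail : ∀ {y s} → NonIncr (y ∷ s) → NonIncr s
NonIncr-tail [ x ]       = []
NonIncr-tail (cons _ s↓) = s↓

sum-take-tail≤ : ∀ {y s} → NonIncr (y ∷ s) → ∀ j → sum (take j s) ≤ sum (take j (y ∷ s))
sum-take-tail≤ _                 zero    = z≤n
sum-take-tail≤ {y} {[]}    _     (suc j) = z≤n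
sum-take-tail≤ {y} {z ∷ s} (cons z≤y s↓) (suc j) = +-mono-≤ z≤y (sum-take-tail≤ s↓ j)

insertDesc-≥ : ∀ {x y} s → y ≤ x → insertDesc x (y ∷ s) ≡ x ∷ y ∷ s
insertDesc-≥ {x} {y} s y≤x with y ≤ᵇ x | ≤ᵇ-reflects-≤ y x
... | true  | _        = refl
... | false | ofⁿ y≰x = contradiction y≤x y≰x

insertDesc-< : ∀ {x y} s → x < y → insertDesc x (y ∷ s) ≡ y ∷ insertDesc x s
insertDesc-< {x} {y} s x<y with y ≤ᵇ x | ≤ᵇ-reflects-≤ y x
... | true  | ofʸ y≤x = contradiction y≤x (<⇒≱ x<y)
... | false | _        = refl

insertDesc-length : ∀ x s → length (insertDesc x s) ≡ suc (length s)
insertDesc-length x []      = refl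
insertDesc-length x (y ∷ s) with y ≤ᵇ x
... | true  = refl
... | false = cong suc (insertDesc-length x s)

sortDesc-length : ∀ l → length (sortDesc l) ≡ length l
sortDesc-length []      = refl
sortDesc-length (x ∷ l) = trans (insertDesc-length x (sortDesc l)) (cong suc (sortDesc-length l))

insertDesc-sum : ∀ x s → sum (insertDesc x s) ≡ x + sum s
insertDesc-sum x []      = refl
insertDesc-sum x (y ∷ s) with y ≤ᵇ x
... | true  = refl
... | false = trans (cong (y +_) (insertDesc-sum x s)) (x+[y+z]≡y+[x+z] y x (sum s))
  where
  x+[y+z]≡y+[x+z] : ∀ a b c → a + (b + c) ≡ b + (a + c)
  x+[y+z]≡y+[x+z] = solve-∀

sortDesc-sum : ∀ l → sum (sortDesc l) ≡ sum l
sortDesc-sum []      = refl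
sortDesc-sum (x ∷ l) = trans (insertDesc-sum x (sortDesc l)) (cong (x +_) (sortDesc-sum l))

insertDesc-nonIncr : ∀ x s → NonIncr s → NonIncr (insertDesc x s)
insertDesc-nonIncr x []      _  = [ x ]
insertDesc-nonIncr x (y ∷ s) s↓ with y ≤ᵇ x | ≤ᵇ-reflects-≤ y x
... | true  | ofʸ y≤x = cons y≤x s↓
insertDesc-nonIncr x (y ∷ [])    _             | false | ofⁿ y≰x = cons (<⇒≤ (≰⇒> y≰x)) [ x ]
insertDesc-nonIncr x (y ∷ z ∷ s) (cons z≤y s↓) | false | ofⁿ y≰x
  with z ≤ᵇ x | ≤ᵇ-reflects-≤ z x | insertDesc-nonIncr x (z ∷ s) s↓
... | true  | _ | xzs↓ = cons (<⇒≤ (≰⇒> y≰x)) xzs↓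
... | false | _ | zxs↓ = cons z≤y zxs↓

sortDesc-nonIncr : ∀ l → NonIncr (sortDesc l)
sortDesc-nonIncr []      = []
sortDesc-nonIncr (x ∷ l) = insertDesc-nonIncr x (sortDesc l) (sortDesc-nonIncr l)

insertDesc-comm< : ∀ x y s → x < y → insertDesc x (insertDesc y s) ≡ insertDesc y (insertDesc x s)
insertDesc-comm< x y [] x<y rewrite insertDesc-< [] x<y | insertDesc-≥ [] (<⇒≤ x<y) = refl
insertDesc-comm< x y (z ∷ s) x<y with z ≤? y | z ≤? x
... | yes z≤y | yes z≤x
  rewrite insertDesc-≥ s z≤y | insertDesc-< (z ∷ s) x<y | insertDesc-≥ s z≤x | insertDesc-≥ (z ∷ s) (<⇒≤ x<y) = refl
... | yes z≤y | no z≰x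
  rewrite insertDesc-≥ s z≤y | insertDesc-< (z ∷ s) x<y | insertDesc-< s (≰⇒> z≰x) | insertDesc-≥ (insertDesc x s) z≤y = refl
... | no z≰y | _
  rewrite insertDesc-< s (≰⇒> z≰y) | insertDesc-< (insertDesc y s) (<-trans x<y (≰⇒> z≰y))
        | insertDesc-< s (<-trans x<y (≰⇒> z≰y)) | insertDesc-< (insertDesc x s) (≰⇒> z≰y) =
  cong (z ∷_) (insertDesc-comm< x y s x<y)

insertDesc-comm : ∀ x y s → insertDesc x (insertDesc y s) ≡ insertDesc y (insertDesc x s)
insertDesc-comm x y s with <-cmp x y
... | tri< x<y _ _    = insertDesc-comm< x y s x<y
... | tri≈ _ refl _   = refl
... | tri> _ _ y<x    = sym (insertDesc-comm< y x s y<x)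

sortDesc-snoc : ∀ l y → sortDesc (l ++ y ∷ []) ≡ insertDesc y (sortDesc l)
sortDesc-snoc []      y = refl
sortDesc-snoc (x ∷ l) y = trans (cong (insertDesc x) (sortDesc-snoc l y)) (insertDesc-comm x y (sortDesc l))

sum-take-insertDesc-mono : ∀ j x s → NonIncr s → sum (take j s) ≤ sum (take j (insertDesc x s))
sum-take-insertDesc-mono zero    x s       _  = z≤n
sum-take-insertDesc-mono (suc j) x []      _  = z≤n
sum-take-insertDesc-mono (suc j) x (y ∷ s) s↓ with y ≤ᵇ x | ≤ᵇ-reflects-≤ y x
... | true  | ofʸ y≤x = +-mono-≤ y≤x (sum-take-tail≤ s↓ j)
... | false | _        = +-monoʳ-≤ y (sum-take-insertDesc-mono j x s (NonIncr-tail s↓))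

sum-take-insertDesc-lower : ∀ j x s → sum (take j s) + x ≤ sum (take (suc j) (insertDesc x s))
sum-take-insertDesc-lower j x [] = ≤-reflexive (+-comm _ x)
sum-take-insertDesc-lower j x (y ∷ s) with y ≤ᵇ x | ≤ᵇ-reflects-≤ y x
... | true  | _ = ≤-reflexive (+-comm _ x)
sum-take-insertDesc-lower zero    x (y ∷ s) | false | ofⁿ y≰x = ≤-trans (<⇒≤ (≰⇒> y≰x)) (m≤m+n y 0)
sum-take-insertDesc-lower (suc j) x (y ∷ s) | false | _ =
  ≤-trans (≤-reflexive (+-assoc y _ x)) (+-monoʳ-≤ y (sum-take-insertDesc-lower j x s))

sum-take-insertDesc-upper : ∀ j x s →
  sum (take (suc j) (insertDesc x s)) ≤ sum (take (suc j) s) ⊔ (sum (take j s) + x)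
sum-take-insertDesc-upper j x [] = ≤-reflexive (+-comm x _)
sum-take-insertDesc-upper j x (y ∷ s) with y ≤ᵇ x
... | true = ≤-trans (≤-reflexive (+-comm x _)) (m≤n⊔m _ _)
sum-take-insertDesc-upper zero    x (y ∷ s) | false = m≤m⊔n _ _
sum-take-insertDesc-upper (suc j) x (y ∷ s) | false =
  ≤-trans (+-monoʳ-≤ y (sum-take-insertDesc-upper j x s))
    (≤-reflexive (trans (+-distribˡ-⊔ y _ _) (cong ((y + sum (take (suc j) s)) ⊔_) (sym (+-assoc y _ x)))))

-- Shapes, horizontal strips and dominance

-- A Young diagram with at most k rows, given by its row lengths f 1, f 2, …; the value f 0 plays no role.
record Shape (k : ℕ) (f : ℕ → ℕ) : Set where
  field
    nonIncr : ∀ i → 1 ≤ i → f (suc i) ≤ f i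
    vanish  : ∀ i → k < i → f i ≡ 0

nonempty-row≤k : ∀ {k f} → Shape k f → ∀ i → 1 ≤ f i → i ≤ k
nonempty-row≤k {k} sh i 1≤fi with i ≤? k
... | yes i≤k = i≤k
... | no  i≰k = contradiction (≤-reflexive (Shape.vanish sh i (≰⇒> i≰k))) (<⇒≱ 1≤fi)

HorizontalStrip : (ℕ → ℕ) → (ℕ → ℕ) → Set
HorizontalStrip f ρ = ∀ i → 1 ≤ i → ρ i ≤ f i × f (suc i) ≤ ρ i

Shape-inner : ∀ {k f ρ} → Shape k f → HorizontalStrip f ρ → Shape k ρ
Shape-inner sh strip = record
  { nonIncr = λ i 1≤i → ≤-trans (proj₁ (strip (suc i) (s≤s z≤n))) (proj₂ (strip i 1≤i))
  ; vanish  = λ i k<i → n≤0⇒n≡0 (≤-trans (proj₁ (strip i (≤-trans (s≤s z≤n) k<i))) (≤-reflexive (Shape.vanish sh i k<i)))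
  }

_⊴_ : List ℕ → (ℕ → ℕ) → Set
s ⊴ f = ∀ j → sum (take j s) ≤ sumTo j f

⊴-cong : ∀ {s f g} → s ⊴ f → (∀ i → f i ≡ g i) → s ⊴ g
⊴-cong s⊴f f≡g j = ≤-trans (s⊴f j) (≤-reflexive (sumTo-cong j (λ i _ _ → f≡g i)))

⊴-inner⇒⊴ : ∀ {s f ρ} → HorizontalStrip f ρ → s ⊴ ρ → s ⊴ f
⊴-inner⇒⊴ strip s⊴ρ j = ≤-trans (s⊴ρ j) (sumTo-mono j (λ i 1≤i _ → proj₁ (strip i 1≤i)))

-- The strip cells in rows j+1, …, N lie in distinct columns, all between f (N+1) and f (j+1).
strip-telescope : ∀ {f ρ} → HorizontalStrip f ρ → ∀ j {N} → j ≤ N →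
                  sumTo N f + sumTo j ρ + f (suc N) ≤ sumTo N ρ + sumTo j f + f (suc j)
strip-telescope {f} {ρ} strip j j≤N = go (≤⇒≤′ j≤N)
  where
  reorder₁ : ∀ a b c d → a + c + b + d ≡ a + b + c + d
  reorder₁ = solve-∀
  reorder₂ : ∀ a b c d → a + b + c + d ≡ a + d + b + c
  reorder₂ = solve-∀
  go : ∀ {N} → j ≤′ N → sumTo N f + sumTo j ρ + f (suc N) ≤ sumTo N ρ + sumTo j f + f (suc j)
  go ≤′-refl           = ≤-reflexive (cong (_+ f (suc j)) (+-comm (sumTo j f) (sumTo j ρ)))
  go (≤′-step {N} j≤N) = begin
    sumTo N f + f (suc N) + sumTo j ρ + f (suc (suc N)) ≡⟨ reorder₁ (sumTo N f) (sumTo j ρ) (f (suc N)) _ ⟩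
    sumTo N f + sumTo j ρ + f (suc N) + f (suc (suc N)) ≤⟨ +-mono-≤ (go j≤N) (proj₂ (strip (suc N) (s≤s z≤n))) ⟩
    sumTo N ρ + sumTo j f + f (suc j) + ρ (suc N)       ≡⟨ reorder₂ (sumTo N ρ) (sumTo j f) (f (suc j)) _ ⟩
    sumTo N ρ + ρ (suc N) + sumTo j f + f (suc j)       ∎
    where open ≤-Reasoning

strip-size-bound : ∀ {k f ρ y} → Shape k f → HorizontalStrip f ρ → sumTo k ρ + y ≡ sumTo k f →
                   ∀ j → sumTo j ρ + y ≤ sumTo (suc j) f
strip-size-bound {k} {f} {ρ} {y} sh strip size j with ≤-total j k
... | inj₁ j≤k = +-cancelˡ-≤ (sumTo k ρ) _ _ (begin
  sumTo k ρ + (sumTo j ρ + y)                    ≡⟨ reorder (sumTo k ρ) (sumTo j ρ) y ⟩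
  sumTo k ρ + y + sumTo j ρ                      ≡⟨ cong (_+ sumTo j ρ) size ⟩
  sumTo k f + sumTo j ρ                          ≤⟨ m≤m+n _ (f (suc k)) ⟩
  sumTo k f + sumTo j ρ + f (suc k)              ≤⟨ strip-telescope strip j j≤k ⟩
  sumTo k ρ + sumTo j f + f (suc j)              ≡⟨ +-assoc (sumTo k ρ) _ _ ⟩
  sumTo k ρ + (sumTo j f + f (suc j))            ∎)
  where
  open ≤-Reasoning
  reorder : ∀ a b c → a + (b + c) ≡ a + c + b
  reorder = solve-∀
... | inj₂ k≤j = begin
  sumTo j ρ + y       ≡⟨ cong (_+ y) (sumTo-vanishing ρ (Shape.vanish (Shape-inner sh strip)) k≤j) ⟩
  sumTo k ρ + y       ≡⟨ size ⟩
  sumTo k f           ≡⟨ sumTo-vanishing f (Shape.vanish sh) k≤j ⟨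
  sumTo j f           ≤⟨ m≤m+n _ _ ⟩
  sumTo (suc j) f     ∎
  where open ≤-Reasoning

⊴-inner⇒insertDesc-⊴ : ∀ {k f ρ s y} → Shape k f → HorizontalStrip f ρ → sumTo k ρ + y ≡ sumTo k f →
                        s ⊴ ρ → insertDesc y s ⊴ f
⊴-inner⇒insertDesc-⊴ {s = s} {y} sh strip size s⊴ρ zero    = z≤n
⊴-inner⇒insertDesc-⊴ {s = s} {y} sh strip size s⊴ρ (suc j) =
  ≤-trans (sum-take-insertDesc-upper j y s)
    (⊔-lub (⊴-inner⇒⊴ strip s⊴ρ (suc j))
           (≤-trans (+-monoˡ-≤ y (s⊴ρ j)) (strip-size-bound sh strip size j)))

-- Choosing a horizontal strip

m∸o≤[m∸n]+[n∸o] : ∀ m n o → o ≤ n → m ∸ o ≤ (m ∸ n) + (n ∸ o)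
m∸o≤[m∸n]+[n∸o] m n o o≤n = m≤n+o⇒m∸n≤o m o (begin
  m                       ≤⟨ m≤n+m∸n m n ⟩
  n + (m ∸ n)             ≤⟨ +-monoˡ-≤ (m ∸ n) (m≤n+m∸n n o) ⟩
  o + (n ∸ o) + (m ∸ n)   ≡⟨ reorder o (n ∸ o) (m ∸ n) ⟩
  o + ((m ∸ n) + (n ∸ o)) ∎)
  where
  open ≤-Reasoning
  reorder : ∀ a b c → a + b + c ≡ a + (c + b)
  reorder = solve-∀

[o∸[n∸m]]+n≡o+m : ∀ {m n o} → m ≤ n → n ∸ m ≤ o → (o ∸ (n ∸ m)) + n ≡ o + m
[o∸[n∸m]]+n≡o+m {m} {n} {o} m≤n n∸m≤o = begin
  (o ∸ (n ∸ m)) + n             ≡⟨ cong ((o ∸ (n ∸ m)) +_) (m∸n+n≡m m≤n) ⟨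
  (o ∸ (n ∸ m)) + ((n ∸ m) + m) ≡⟨ +-assoc (o ∸ (n ∸ m)) _ m ⟨
  (o ∸ (n ∸ m)) + (n ∸ m) + m   ≡⟨ cong (_+ m) (m∸n+n≡m n∸m≤o) ⟩
  o + m                         ∎
  where open ≡-Reasoning

-- Row i loses m i ∸ m (i ∸ 1) cells, so that m j cells are removed from the first j rows.
trimRows : (ℕ → ℕ) → (ℕ → ℕ) → ℕ → ℕ
trimRows f m i = f i ∸ (m i ∸ m (pred i))

trimRows-strip : ∀ {k f} (m : ℕ → ℕ) → Shape k f →
                 (∀ j → m (suc j) ∸ m j ≤ f (suc j) ∸ f (suc (suc j))) → HorizontalStrip f (trimRows f m)
trimRows-strip {f = f} m sh step (suc j) _ =
  m∸n≤m (f (suc j)) (m (suc j) ∸ m j) ,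
  ≤-trans (≤-reflexive (sym (m∸[m∸n]≡n (Shape.nonIncr sh (suc j) (s≤s z≤n))))) (∸-monoʳ-≤ (f (suc j)) (step j))

sumTo-trimRows : ∀ (f m : ℕ → ℕ) → m 0 ≡ 0 → (∀ j → m j ≤ m (suc j)) → (∀ j → m (suc j) ∸ m j ≤ f (suc j)) →
                 ∀ j → sumTo j (trimRows f m) + m j ≡ sumTo j f
sumTo-trimRows f m m0≡0 m-mono step≤f zero    = m0≡0
sumTo-trimRows f m m0≡0 m-mono step≤f (suc j) = begin
  sumTo j ρ + ρ (suc j) + m (suc j)   ≡⟨ +-assoc (sumTo j ρ) _ _ ⟩
  sumTo j ρ + (ρ (suc j) + m (suc j)) ≡⟨ cong (sumTo j ρ +_) ([o∸[n∸m]]+n≡o+m (m-mono j) (step≤f j)) ⟩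
  sumTo j ρ + (f (suc j) + m j)       ≡⟨ cong (sumTo j ρ +_) (+-comm (f (suc j)) (m j)) ⟩
  sumTo j ρ + (m j + f (suc j))       ≡⟨ +-assoc (sumTo j ρ) _ _ ⟨
  sumTo j ρ + m j + f (suc j)         ≡⟨ cong (_+ f (suc j)) (sumTo-trimRows f m m0≡0 m-mono step≤f j) ⟩
  sumTo j f + f (suc j)               ∎
  where
  open ≡-Reasoning
  ρ = trimRows f m

-- e j is a prescribed lower bound for the number of strip cells in the first j rows.  Since rows
-- j+1, j+2, … can hold at most f (j+1) strip cells, at least x ∸ f (j+1) of them lie in the first j
-- rows; taking exactly m j = e j ⊔ (x ∸ f (j+1)) there keeps s dominated.
module ChooseStrip {k f} (sh : Shape k f) (x : ℕ) (s : List ℕ) (e : ℕ → ℕ)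
  (e0≡0 : e 0 ≡ 0) (e-mono : ∀ j → e j ≤ e (suc j)) (e-step : ∀ j → e (suc j) ≤ e j + (f (suc j) ∸ f (suc (suc j))))
  (e≤x : ∀ j → e j ≤ x) (s+e≤f : ∀ j → sum (take j s) + e j ≤ sumTo j f)
  (s+x≤f : ∀ j → sum (take j s) + x ≤ sumTo (suc j) f) where

  private
    m : ℕ → ℕ
    m j = e j ⊔ (x ∸ f (suc j))

    m-mono : ∀ j → m j ≤ m (suc j)
    m-mono j = ⊔-mono-≤ (e-mono j) (∸-monoʳ-≤ x (Shape.nonIncr sh (suc j) (s≤s z≤n)))

    m-step : ∀ j → m (suc j) ∸ m j ≤ f (suc j) ∸ f (suc (suc j))
    m-step j = m≤n+o⇒m∸n≤o (m (suc j)) (m j) (⊔-lub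
      (≤-trans (e-step j) (+-monoˡ-≤ _ (m≤m⊔n (e j) _)))
      (≤-trans (m∸o≤[m∸n]+[n∸o] x (f (suc j)) _ (Shape.nonIncr sh (suc j) (s≤s z≤n))) (+-monoˡ-≤ _ (m≤n⊔m (e j) _))))

    m-step≤f : ∀ j → m (suc j) ∸ m j ≤ f (suc j)
    m-step≤f j = ≤-trans (m-step j) (m∸n≤m (f (suc j)) (f (suc (suc j))))

    m0≡0 : m 0 ≡ 0
    m0≡0 rewrite e0≡0 = m≤n⇒m∸n≡0 (s+x≤f 0)

    mk≡x : m k ≡ x
    mk≡x rewrite Shape.vanish sh (suc k) ≤-refl = m≤n⇒m⊔n≡n (e≤x k)

    s+m≤f : ∀ j → sum (take j s) + m j ≤ sumTo j f
    s+m≤f j = ≤-trans (≤-reflexive (+-distribˡ-⊔ (sum (take j s)) (e j) _)) (⊔-lub (s+e≤f j) s+[x∸f]≤f)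
      where
      s+[x∸f]≤f : sum (take j s) + (x ∸ f (suc j)) ≤ sumTo j f
      s+[x∸f]≤f with x ≤? f (suc j)
      ... | yes x≤f rewrite m≤n⇒m∸n≡0 x≤f = ≤-trans (≤-reflexive (+-identityʳ _)) (m+n≤o⇒m≤o _ (s+e≤f j))
      ... | no  x≰f = +-cancelʳ-≤ (f (suc j)) _ _ (≤-trans (≤-reflexive (begin-equality
        sum (take j s) + (x ∸ f (suc j)) + f (suc j)   ≡⟨ +-assoc (sum (take j s)) _ _ ⟩
        sum (take j s) + (x ∸ f (suc j) + f (suc j))   ≡⟨ cong (sum (take j s) +_) (m∸n+n≡m (<⇒≤ (≰⇒> x≰f))) ⟩
        sum (take j s) + x                             ∎)) (s+x≤f j))
        where open ≤-Reasoning

    m-rises : ∀ j → e j < e (suc j) → m j < m (suc j)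
    m-rises j ej<ej+1 = ⊔-lub (≤-trans ej<ej+1 (m≤m⊔n _ _)) x∸f<m
      where
      row-shortens : f (suc (suc j)) < f (suc j)
      row-shortens with f (suc (suc j)) <? f (suc j)
      ... | yes f″<f′ = f″<f′
      ... | no  f″≮f′ = contradiction (≤-trans (e-step j) (≤-reflexive (trans
                          (cong (e j +_) (m≤n⇒m∸n≡0 (≮⇒≥ f″≮f′))) (+-identityʳ (e j))))) (<⇒≱ ej<ej+1)
      x∸f<m : x ∸ f (suc j) < m (suc j)
      x∸f<m with x ≤? f (suc j)
      ... | yes x≤f rewrite m≤n⇒m∸n≡0 x≤f = ≤-trans (≤-trans (s≤s z≤n) ej<ej+1) (m≤m⊔n _ _)
      ... | no  x≰f = ≤-trans (∸-monoʳ-< row-shortens (<⇒≤ (≰⇒> x≰f))) (m≤n⊔m _ _)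

  inner : ℕ → ℕ
  inner = trimRows f m

  isStrip : HorizontalStrip f inner
  isStrip = trimRows-strip m sh m-step

  private
    sumTo-inner : ∀ j → sumTo j inner + m j ≡ sumTo j f
    sumTo-inner = sumTo-trimRows f m m0≡0 m-mono m-step≤f

  size : sumTo k inner + x ≡ sumTo k f
  size = trans (cong (sumTo k inner +_) (sym mk≡x)) (sumTo-inner k)

  dominated : s ⊴ inner
  dominated j = +-cancelʳ-≤ (m j) _ _ (≤-trans (s+m≤f j) (≤-reflexive (sym (sumTo-inner j))))

  shrinks : ∀ j → e j < e (suc j) → inner (suc j) < f (suc j)
  shrinks j ej<ej+1 = ∸-monoʳ-< (m<n⇒0<n∸m (m-rises j ej<ej+1)) (m-step≤f j)

InShape : ℕ → (ℕ → ℕ) → ℕ → ℕ → Set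
InShape k f i j = (1 ≤ i) × (i ≤ k) × (1 ≤ j) × (j ≤ f i)

count : ℕ → (ℕ → ℕ) → (ℕ → ℕ → ℕ) → ℕ → ℕ
count k f T v = sumTo k (λ i → sumTo (f i) (λ j → indic (T i j) v))

-- IsSTab with the shape and the content given as functions, so that shapes can be shrunk row by row.
record Tableau (k : ℕ) (f : ℕ → ℕ) (h : ℕ) (α : ℕ → ℕ) (T : ℕ → ℕ → ℕ) : Set where
  field
    range  : ∀ i j → InShape k f i j → (1 ≤ T i j) × (T i j ≤ h)
    rowWk  : ∀ i j → InShape k f i j → InShape k f i (suc j) → T i j ≤ T i (suc j)
    colStr : ∀ i j → InShape k f i j → InShape k f (suc i) j → T i j < T (suc i) j
    counts : ∀ v → 1 ≤ v → v ≤ h → count k f T v ≡ α v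

indic-refl : ∀ v → indic v v ≡ 1
indic-refl v with v ≟ v
... | yes _   = refl
... | no  v≢v = contradiction refl v≢v

indic-≢ : ∀ {x v} → x ≢ v → indic x v ≡ 0
indic-≢ {x} {v} x≢v with x ≟ v
... | yes x≡v = contradiction x≡v x≢v
... | no  _   = refl

module SplitRow (t : ℕ → ℕ) (h p n : ℕ) (p≤n : p ≤ n)
  (low : ∀ j → 1 ≤ j → j ≤ p → t j ≤ h) (top : ∀ j → p < j → j ≤ n → t j ≡ suc h) where

  count-low : ∀ v → v ≤ h → sumTo n (λ j → indic (t j) v) ≡ sumTo p (λ j → indic (t j) v)
  count-low v v≤h = go (≤⇒≤′ p≤n) ≤-refl
    where
    go : ∀ {m} → p ≤′ m → m ≤ n → sumTo m (λ j → indic (t j) v) ≡ sumTo p (λ j → indic (t j) v)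
    go ≤′-refl           _   = refl
    go (≤′-step {m} p≤m) m<n = begin
      sumTo m (λ j → indic (t j) v) + indic (t (suc m)) v ≡⟨ cong (sumTo m (λ j → indic (t j) v) +_) (indic-≢ t≢v) ⟩
      sumTo m (λ j → indic (t j) v) + 0                   ≡⟨ +-identityʳ _ ⟩
      sumTo m (λ j → indic (t j) v)                       ≡⟨ go p≤m (≤-trans (n≤1+n m) m<n) ⟩
      sumTo p (λ j → indic (t j) v)                       ∎
      where
      open ≡-Reasoning
      t≢v : t (suc m) ≢ v
      t≢v t≡v = ≤⇒≯ v≤h (≤-reflexive (trans (sym (top (suc m) (s≤s (≤′⇒≤ p≤m)) m<n)) t≡v))

  count-top : sumTo n (λ j → indic (t j) (suc h)) ≡ n ∸ p
  count-top = go (≤⇒≤′ p≤n) ≤-refl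
    where
    none-low : ∀ m → m ≤ p → sumTo m (λ j → indic (t j) (suc h)) ≡ 0
    none-low zero    _   = refl
    none-low (suc m) m<p = cong₂ _+_ (none-low m (≤-trans (n≤1+n m) m<p))
      (indic-≢ (λ t≡h+1 → <⇒≱ (s≤s (low (suc m) (s≤s z≤n) m<p)) (≤-reflexive (sym t≡h+1))))
    go : ∀ {m} → p ≤′ m → m ≤ n → sumTo m (λ j → indic (t j) (suc h)) ≡ m ∸ p
    go ≤′-refl           _   = trans (none-low p ≤-refl) (sym (n∸n≡0 p))
    go (≤′-step {m} p≤m) m<n = trans
      (cong₂ _+_ (go p≤m (≤-trans (n≤1+n m) m<n))
                 (trans (cong (λ u → indic u (suc h)) (top (suc m) (s≤s (≤′⇒≤ p≤m)) m<n)) (indic-refl (suc h))))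
      (trans (+-comm _ 1) (sym (+-∸-assoc 1 (≤′⇒≤ p≤m))))

WeaklyIncreasingUpTo : (ℕ → ℕ) → ℕ → Set
WeaklyIncreasingUpTo t p = ∀ j j′ → 1 ≤ j → j ≤ j′ → j′ ≤ p → t j ≤ t j′

lastAtMost : (ℕ → ℕ) → ℕ → ℕ → ℕ
lastAtMost t h zero    = 0
lastAtMost t h (suc p) with t (suc p) ≤? h
... | yes _ = suc p
... | no  _ = lastAtMost t h p

module _ (t : ℕ → ℕ) (h : ℕ) where

  lastAtMost-≤ : ∀ p → lastAtMost t h p ≤ p
  lastAtMost-≤ zero    = z≤n
  lastAtMost-≤ (suc p) with t (suc p) ≤? h
  ... | yes _ = ≤-refl
  ... | no  _ = m≤n⇒m≤1+n (lastAtMost-≤ p)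

  lastAtMost-before : ∀ p → WeaklyIncreasingUpTo t p → ∀ j → 1 ≤ j → j ≤ lastAtMost t h p → t j ≤ h
  lastAtMost-before zero    t↑ j 1≤j j≤0 = ⊥-elim (<⇒≱ 1≤j j≤0)
  lastAtMost-before (suc p) t↑ j 1≤j j≤ℓ with t (suc p) ≤? h
  ... | yes tp≤h = ≤-trans (t↑ j (suc p) 1≤j j≤ℓ ≤-refl) tp≤h
  ... | no  _    = lastAtMost-before p (λ j j′ a b c → t↑ j j′ a b (m≤n⇒m≤1+n c)) j 1≤j j≤ℓ

  lastAtMost-after : ∀ p → WeaklyIncreasingUpTo t p → ∀ j → lastAtMost t h p < j → j ≤ p → h < t j
  lastAtMost-after zero    t↑ j ℓ<j j≤0 = ⊥-elim (<⇒≱ ℓ<j j≤0)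
  lastAtMost-after (suc p) t↑ j ℓ<j j≤p with t (suc p) ≤? h
  ... | yes _    = ⊥-elim (<⇒≱ ℓ<j j≤p)
  ... | no  tp≰h with j ≟ suc p
  ...   | yes refl = ≰⇒> tp≰h
  ...   | no  j≢p  = lastAtMost-after p (λ j j′ a b c → t↑ j j′ a b (m≤n⇒m≤1+n c)) j ℓ<j (≤-pred (≤∧≢⇒< j≤p j≢p))

Tableau-row-weaklyIncreasing : ∀ {k f h α T} → Tableau k f h α T → ∀ i → 1 ≤ i → i ≤ k →
                               WeaklyIncreasingUpTo (T i) (f i)
Tableau-row-weaklyIncreasing {f = f} {T = T} tab i 1≤i i≤k j j′ 1≤j j≤j′ j′≤fi = go (≤⇒≤′ j≤j′) j′≤fi
  where
  go : ∀ {m} → j ≤′ m → m ≤ f i → T i j ≤ T i m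
  go ≤′-refl           _    = ≤-refl
  go (≤′-step {m} j≤m) m<fi = ≤-trans (go j≤m (≤-trans (n≤1+n m) m<fi))
    (Tableau.rowWk tab i m (1≤i , i≤k , ≤-trans 1≤j (≤′⇒≤ j≤m) , ≤-trans (n≤1+n m) m<fi) (1≤i , i≤k , s≤s z≤n , m<fi))

-- Removing and adding the largest entry

module RemoveTop {k f h α T} (sh : Shape k f) (tab : Tableau k f (suc h) α T) where

  inner : ℕ → ℕ
  inner i = lastAtMost (T i) h (f i)

  inner≤f : ∀ i → inner i ≤ f i
  inner≤f i = lastAtMost-≤ (T i) h (f i)

  low : ∀ i → 1 ≤ i → i ≤ k → ∀ j → 1 ≤ j → j ≤ inner i → T i j ≤ h
  low i 1≤i i≤k = lastAtMost-before (T i) h (f i) (Tableau-row-weaklyIncreasing tab i 1≤i i≤k)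

  high : ∀ i → 1 ≤ i → i ≤ k → ∀ j → inner i < j → j ≤ f i → h < T i j
  high i 1≤i i≤k = lastAtMost-after (T i) h (f i) (Tableau-row-weaklyIncreasing tab i 1≤i i≤k)

  top : ∀ i → 1 ≤ i → i ≤ k → ∀ j → inner i < j → j ≤ f i → T i j ≡ suc h
  top i 1≤i i≤k j ρ<j j≤f =
    ≤-antisym (proj₂ (Tableau.range tab i j (1≤i , i≤k , ≤-trans (s≤s z≤n) ρ<j , j≤f))) (high i 1≤i i≤k j ρ<j j≤f)

  -- An entry h+1 in row i above a cell of row i+1 would leave no room for that cell's entry.
  isStrip : HorizontalStrip f inner
  isStrip i 1≤i = inner≤f i , next≤inner
    where
    next≤inner : f (suc i) ≤ inner i
    next≤inner with inner i <? f (suc i)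
    ... | no  ρ≮f = ≮⇒≥ ρ≮f
    ... | yes ρ<f = contradiction below≤h+1 (<⇒≱ (≤-trans (s≤s above>h) column))
      where
      1≤f = ≤-trans (s≤s z≤n) ρ<f
      i+1≤k = nonempty-row≤k sh (suc i) 1≤f
      i≤k = ≤-trans (n≤1+n i) i+1≤k
      f′≤f = Shape.nonIncr sh i 1≤i
      above>h : h < T i (f (suc i))
      above>h = high i 1≤i i≤k (f (suc i)) ρ<f f′≤f
      column : T i (f (suc i)) < T (suc i) (f (suc i))
      column = Tableau.colStr tab i (f (suc i)) (1≤i , i≤k , 1≤f , f′≤f) (s≤s z≤n , i+1≤k , 1≤f , ≤-refl)
      below≤h+1 : T (suc i) (f (suc i)) ≤ suc h
      below≤h+1 = proj₂ (Tableau.range tab (suc i) (f (suc i)) (s≤s z≤n , i+1≤k , 1≤f , ≤-refl))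

  private
    cell-in-f : ∀ {i j} → InShape k inner i j → InShape k f i j
    cell-in-f {i} (1≤i , i≤k , 1≤j , j≤ρ) = 1≤i , i≤k , 1≤j , ≤-trans j≤ρ (inner≤f i)

    module Row i (1≤i : 1 ≤ i) (i≤k : i ≤ k) =
      SplitRow (T i) h (inner i) (f i) (inner≤f i) (low i 1≤i i≤k) (top i 1≤i i≤k)

  tableau : Tableau k inner h α T
  tableau = record
    { range  = λ i j cell@(1≤i , i≤k , 1≤j , j≤ρ) →
                 proj₁ (Tableau.range tab i j (cell-in-f cell)) , low i 1≤i i≤k j 1≤j j≤ρ
    ; rowWk  = λ i j c c′ → Tableau.rowWk tab i j (cell-in-f c) (cell-in-f c′)
    ; colStr = λ i j c c′ → Tableau.colStr tab i j (cell-in-f c) (cell-in-f c′)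
    ; counts = λ v 1≤v v≤h → trans (sumTo-cong k (λ i 1≤i i≤k → sym (Row.count-low i 1≤i i≤k v v≤h)))
                                   (Tableau.counts tab v 1≤v (m≤n⇒m≤1+n v≤h))
    }

  size : sumTo k inner + α (suc h) ≡ sumTo k f
  size = begin
    sumTo k inner + α (suc h)                    ≡⟨ cong (sumTo k inner +_) (Tableau.counts tab (suc h) (s≤s z≤n) ≤-refl) ⟨
    sumTo k inner + count k f T (suc h)          ≡⟨ cong (sumTo k inner +_) (sumTo-cong k Row.count-top) ⟩
    sumTo k inner + sumTo k (λ i → f i ∸ inner i) ≡⟨ sumTo-∸ k f inner (λ i _ _ → inner≤f i) ⟩
    sumTo k f                                    ∎
    where open ≡-Reasoning

  top-outside : ∀ r → 1 ≤ r → r ≤ k → 1 ≤ f r → T r (f r) ≡ suc h → inner r < f r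
  top-outside r 1≤r r≤k 1≤fr T≡h+1 with inner r <? f r
  ... | yes ρ<f = ρ<f
  ... | no  ρ≮f = contradiction (low r 1≤r r≤k (f r) 1≤fr (≮⇒≥ ρ≮f)) (<⇒≱ (≤-reflexive (sym T≡h+1)))

fillStrip : (ℕ → ℕ → ℕ) → (ℕ → ℕ) → ℕ → ℕ → ℕ → ℕ
fillStrip T ρ h i j with j ≤? ρ i
... | yes _ = T i j
... | no  _ = suc h

fillStrip-inner : ∀ T ρ h i j → j ≤ ρ i → fillStrip T ρ h i j ≡ T i j
fillStrip-inner T ρ h i j j≤ρ with j ≤? ρ i
... | yes _   = refl
... | no  j≰ρ = contradiction j≤ρ j≰ρ

fillStrip-outer : ∀ T ρ h i j → ρ i < j → fillStrip T ρ h i j ≡ suc h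
fillStrip-outer T ρ h i j ρ<j with j ≤? ρ i
... | yes j≤ρ = contradiction j≤ρ (<⇒≱ ρ<j)
... | no  _   = refl

module FillStrip {k f ρ h α T} (strip : HorizontalStrip f ρ) (tab : Tableau k ρ h α T)
                 (size : sumTo k ρ + α (suc h) ≡ sumTo k f) where

  private
    T⁺ = fillStrip T ρ h

    low : ∀ i j → 1 ≤ i → i ≤ k → 1 ≤ j → j ≤ ρ i → T⁺ i j ≤ h
    low i j 1≤i i≤k 1≤j j≤ρ =
      ≤-trans (≤-reflexive (fillStrip-inner T ρ h i j j≤ρ)) (proj₂ (Tableau.range tab i j (1≤i , i≤k , 1≤j , j≤ρ)))

    range : ∀ i j → InShape k f i j → (1 ≤ T⁺ i j) × (T⁺ i j ≤ suc h)
    range i j (1≤i , i≤k , 1≤j , _) with j ≤? ρ i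
    ... | yes j≤ρ = let (1≤T , T≤h) = Tableau.range tab i j (1≤i , i≤k , 1≤j , j≤ρ) in 1≤T , m≤n⇒m≤1+n T≤h
    ... | no  _   = s≤s z≤n , ≤-refl

    rowWk : ∀ i j → InShape k f i j → InShape k f i (suc j) → T⁺ i j ≤ T⁺ i (suc j)
    rowWk i j (1≤i , i≤k , 1≤j , _) _ = go (suc j ≤? ρ i) (j ≤? ρ i)
      where
      go : Dec (suc j ≤ ρ i) → Dec (j ≤ ρ i) → T⁺ i j ≤ T⁺ i (suc j)
      go (yes j<ρ) _ = begin
        T⁺ i j       ≡⟨ fillStrip-inner T ρ h i j (≤-trans (n≤1+n j) j<ρ) ⟩
        T i j        ≤⟨ Tableau.rowWk tab i j (1≤i , i≤k , 1≤j , ≤-trans (n≤1+n j) j<ρ) (1≤i , i≤k , s≤s z≤n , j<ρ) ⟩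
        T i (suc j)  ≡⟨ fillStrip-inner T ρ h i (suc j) j<ρ ⟨
        T⁺ i (suc j) ∎
        where open ≤-Reasoning
      go (no j≮ρ) (yes j≤ρ) = ≤-trans (m≤n⇒m≤1+n (low i j 1≤i i≤k 1≤j j≤ρ))
                                      (≤-reflexive (sym (fillStrip-outer T ρ h i (suc j) (≰⇒> j≮ρ))))
      go (no j≮ρ) (no j≰ρ)  = ≤-reflexive (trans (fillStrip-outer T ρ h i j (≰⇒> j≰ρ))
                                                 (sym (fillStrip-outer T ρ h i (suc j) (≰⇒> j≮ρ))))

    colStr : ∀ i j → InShape k f i j → InShape k f (suc i) j → T⁺ i j < T⁺ (suc i) j
    colStr i j (1≤i , i≤k , 1≤j , _) (_ , i+1≤k , _ , j≤f′) = go (j ≤? ρ (suc i))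
      where
      j≤ρ = ≤-trans j≤f′ (proj₂ (strip i 1≤i))
      go : Dec (j ≤ ρ (suc i)) → T⁺ i j < T⁺ (suc i) j
      go (yes j≤ρ′) = subst₂ _<_ (sym (fillStrip-inner T ρ h i j j≤ρ)) (sym (fillStrip-inner T ρ h (suc i) j j≤ρ′))
                        (Tableau.colStr tab i j (1≤i , i≤k , 1≤j , j≤ρ) (s≤s z≤n , i+1≤k , 1≤j , j≤ρ′))
      go (no j≰ρ′)  = subst (T⁺ i j <_) (sym (fillStrip-outer T ρ h (suc i) j (≰⇒> j≰ρ′)))
                        (s≤s (low i j 1≤i i≤k 1≤j j≤ρ))

    module Row i (1≤i : 1 ≤ i) (i≤k : i ≤ k) =
      SplitRow (T⁺ i) h (ρ i) (f i) (proj₁ (strip i 1≤i)) (λ j → low i j 1≤i i≤k) (λ j ρ<j _ → fillStrip-outer T ρ h i j ρ<j)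

    counts : ∀ v → 1 ≤ v → v ≤ suc h → count k f T⁺ v ≡ α v
    counts v 1≤v v≤h+1 with v ≟ suc h
    ... | yes refl = +-cancelˡ-≡ (sumTo k ρ) _ _ (begin
      sumTo k ρ + count k f T⁺ (suc h)          ≡⟨ cong (sumTo k ρ +_) (sumTo-cong k Row.count-top) ⟩
      sumTo k ρ + sumTo k (λ i → f i ∸ ρ i)    ≡⟨ sumTo-∸ k f ρ (λ i 1≤i _ → proj₁ (strip i 1≤i)) ⟩
      sumTo k f                                 ≡⟨ size ⟨
      sumTo k ρ + α (suc h)                     ∎)
      where open ≡-Reasoning
    ... | no v≢h+1 = trans
      (sumTo-cong k (λ i 1≤i i≤k → trans (Row.count-low i 1≤i i≤k v v≤h)
        (sumTo-cong (ρ i) (λ j _ j≤ρ → cong (λ u → indic u v) (fillStrip-inner T ρ h i j j≤ρ)))))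
      (Tableau.counts tab v 1≤v v≤h)
      where v≤h = ≤-pred (≤∧≢⇒< v≤h+1 v≢h+1)

  tableau : Tableau k f (suc h) α T⁺
  tableau = record { range = range ; rowWk = rowWk ; colStr = colStr ; counts = counts }

-- Tableaux of a given content exist exactly under dominance

sortDesc-take-suc : ∀ a n → suc n ≤ length a →
                    sortDesc (take (suc n) a) ≡ insertDesc (ent a (suc n)) (sortDesc (take n a))
sortDesc-take-suc a n n<|a| = trans (cong sortDesc (take-suc≡snoc n a n<|a|)) (sortDesc-snoc (take n a) (ent a (suc n)))

-- The summand 0 is the lower bound e = 0 in ChooseStrip.
insertDesc-⊴⇒⊴ : ∀ {x c f} → NonIncr c → insertDesc x c ⊴ f → ∀ j → sum (take j c) + 0 ≤ sumTo j f
insertDesc-⊴⇒⊴ {x} {c} c↓ x∷c⊴f j =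
  ≤-trans (≤-reflexive (+-identityʳ _)) (≤-trans (sum-take-insertDesc-mono j x c c↓) (x∷c⊴f j))

insertDesc-⊴⇒+ : ∀ {x c f} → insertDesc x c ⊴ f → ∀ j → sum (take j c) + x ≤ sumTo (suc j) f
insertDesc-⊴⇒+ {x} {c} x∷c⊴f j = ≤-trans (sum-take-insertDesc-lower j x c) (x∷c⊴f (suc j))

tableau⇒⊴ : ∀ {k f T} a n → Shape k f → n ≤ length a → Tableau k f n (ent a) T → sortDesc (take n a) ⊴ f
tableau⇒⊴ a zero    _ _ _ zero    = z≤n
tableau⇒⊴ a zero    _ _ _ (suc j) = z≤n
tableau⇒⊴ {f = f} a (suc n) sh n<|a| tab =
  subst (_⊴ f) (sym (sortDesc-take-suc a n n<|a|)) (⊴-inner⇒insertDesc-⊴ sh isStrip size c⊴ρ)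
  where
  open RemoveTop sh tab
  c⊴ρ = tableau⇒⊴ a n (Shape-inner sh isStrip) (≤-trans (n≤1+n n) n<|a|) tableau

⊴⇒tableau : ∀ {k f} a n → Shape k f → n ≤ length a → sortDesc (take n a) ⊴ f →
            sumTo k f ≡ sumTo n (ent a) → ∃ (Tableau k f n (ent a))
⊴⇒tableau {k} {f} a zero sh _ _ |f|≡0 = (λ _ _ → 0) , record
  { range  = λ i j cell → ⊥-elim (no-cell cell)
  ; rowWk  = λ _ _ _ _ → ≤-refl
  ; colStr = λ i j cell _ → ⊥-elim (no-cell cell)
  ; counts = λ v 1≤v v≤0 → ⊥-elim (<⇒≱ 1≤v v≤0)
  }
  where
  no-cell : ∀ {i j} → InShape k f i j → ⊥
  no-cell {i} (1≤i , i≤k , 1≤j , j≤fi) = <⇒≱ (≤-trans 1≤j j≤fi) (≤-reflexive (sumTo≡0⇒≡0 k f |f|≡0 i 1≤i i≤k))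
⊴⇒tableau {f = f} a (suc n) sh n<|a| a⊴f |f|≡|a| = fillStrip T ρ n , FillStrip.tableau isStrip tab size
  where
  x = ent a (suc n)
  c = sortDesc (take n a)
  x∷c⊴f : insertDesc x c ⊴ f
  x∷c⊴f = subst (_⊴ f) (sortDesc-take-suc a n n<|a|) a⊴f
  open ChooseStrip sh x c (λ _ → 0) refl (λ _ → z≤n) (λ _ → z≤n) (λ _ → z≤n)
                   (insertDesc-⊴⇒⊴ (sortDesc-nonIncr (take n a)) x∷c⊴f) (insertDesc-⊴⇒+ x∷c⊴f)
    renaming (inner to ρ)
  T-tab = ⊴⇒tableau a n (Shape-inner sh isStrip) (≤-trans (n≤1+n n) n<|a|) dominated
                    (+-cancelʳ-≡ x _ _ (trans size |f|≡|a|))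
  T = proj₁ T-tab
  tab = proj₂ T-tab

-- The largest entry at the end of a row

decRow : (ℕ → ℕ) → ℕ → ℕ → ℕ
decRow f r i = f i ∸ indic i r

decRow-≢ : ∀ f {r i} → i ≢ r → decRow f r i ≡ f i
decRow-≢ f {i = i} i≢r = cong (f i ∸_) (indic-≢ i≢r)

decRow-≤ : ∀ f r i → decRow f r i ≤ f i
decRow-≤ f r i = m∸n≤m (f i) (indic i r)

<⇒≤∸1 : ∀ {m n} → m < n → m ≤ n ∸ 1
<⇒≤∸1 (s≤s m≤n) = m≤n

decRow-shape : ∀ {k f r} → Shape k f → f (suc r) < f r → Shape k (decRow f r)
decRow-shape {k} {f} {r} sh corner = record
  { nonIncr = nonIncr
  ; vanish  = λ i k<i → n≤0⇒n≡0 (≤-trans (decRow-≤ f r i) (≤-reflexive (Shape.vanish sh i k<i)))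
  }
  where
  nonIncr : ∀ i → 1 ≤ i → decRow f r (suc i) ≤ decRow f r i
  nonIncr i 1≤i with i ≟ r
  ... | yes refl = ≤-trans (≤-reflexive (decRow-≢ f (1+n≢n {i}))) (<⇒≤∸1 corner)
  ... | no  _    = ≤-trans (decRow-≤ f r (suc i)) (Shape.nonIncr sh i 1≤i)

decRow-strip : ∀ {f ρ r} → HorizontalStrip f ρ → ρ r < f r → HorizontalStrip (decRow f r) ρ
decRow-strip {f} {ρ} {r} strip ρr<fr i 1≤i = ρ≤f′ , ≤-trans (decRow-≤ f r (suc i)) (proj₂ (strip i 1≤i))
  where
  ρ≤f′ : ρ i ≤ decRow f r i
  ρ≤f′ with i ≟ r
  ... | yes refl = <⇒≤∸1 ρr<fr
  ... | no  _    = proj₁ (strip i 1≤i)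

sumTo-decRow-< : ∀ f r j → j < r → sumTo j (decRow f r) ≡ sumTo j f
sumTo-decRow-< f r zero    _   = refl
sumTo-decRow-< f r (suc j) j<r =
  cong₂ _+_ (sumTo-decRow-< f r j (<-trans (n<1+n j) j<r)) (decRow-≢ f (<⇒≢ j<r))

sumTo-decRow-≥ : ∀ f r → 1 ≤ r → 1 ≤ f r → ∀ {j} → r ≤ j → sumTo j (decRow f r) + 1 ≡ sumTo j f
sumTo-decRow-≥ f (suc r) _ 1≤fr r≤j = go (≤⇒≤′ r≤j)
  where
  open ≡-Reasoning
  go : ∀ {j} → suc r ≤′ j → sumTo j (decRow f (suc r)) + 1 ≡ sumTo j f
  go ≤′-refl = begin
    sumTo r (decRow f (suc r)) + (f (suc r) ∸ indic (suc r) (suc r)) + 1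
      ≡⟨ +-assoc (sumTo r (decRow f (suc r))) _ 1 ⟩
    sumTo r (decRow f (suc r)) + (f (suc r) ∸ indic (suc r) (suc r) + 1)
      ≡⟨ cong₂ _+_ (sumTo-decRow-< f (suc r) r ≤-refl)
                   (trans (cong (λ u → f (suc r) ∸ u + 1) (indic-refl (suc r))) (m∸n+n≡m 1≤fr)) ⟩
    sumTo r f + f (suc r) ∎
  go (≤′-step {j} r≤j) = begin
    sumTo j (decRow f (suc r)) + decRow f (suc r) (suc j) + 1   ≡⟨ reorder (sumTo j (decRow f (suc r))) _ ⟩
    sumTo j (decRow f (suc r)) + 1 + decRow f (suc r) (suc j)   ≡⟨ cong₂ _+_ (go r≤j) (decRow-≢ f j+1≢r) ⟩
    sumTo j f + f (suc j)                                       ∎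
    where
    reorder : ∀ a b → a + b + 1 ≡ a + 1 + b
    reorder = solve-∀
    j+1≢r : suc j ≢ suc r
    j+1≢r j+1≡r = <⇒≢ (s≤s (≤′⇒≤ r≤j)) (sym j+1≡r)

maxEntry-corner : ∀ {k f h α T} → Shape k f → Tableau k f h α T →
                  ∀ r → 1 ≤ r → r ≤ k → 1 ≤ f r → T r (f r) ≡ h → f (suc r) < f r
maxEntry-corner {f = f} {h} {T = T} sh tab r 1≤r r≤k 1≤fr T≡h with f (suc r) <? f r
... | yes corner = corner
... | no  f′≮f   = contradiction below≤h (<⇒≱ (subst (_< T (suc r) (f r)) T≡h column))
  where
  fr≤f′ = ≮⇒≥ f′≮f
  r+1≤k = nonempty-row≤k sh (suc r) (≤-trans 1≤fr fr≤f′)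
  column = Tableau.colStr tab r (f r) (1≤r , r≤k , 1≤fr , ≤-refl) (s≤s z≤n , r+1≤k , 1≤fr , fr≤f′)
  below≤h = proj₂ (Tableau.range tab (suc r) (f r) (s≤s z≤n , r+1≤k , 1≤fr , fr≤f′))

corner-tableau⇒⊴ : ∀ {k f T} a n → Shape k f → suc n ≤ length a → 1 ≤ ent a (suc n) → Tableau k f (suc n) (ent a) T →
  ∀ r → 1 ≤ r → r ≤ k → 1 ≤ f r → f (suc r) < f r → T r (f r) ≡ suc n →
  sortDesc (take n a) ⊴ decRow f r × insertDesc (ent a (suc n) ∸ 1) (sortDesc (take n a)) ⊴ decRow f r
corner-tableau⇒⊴ {k} {f} a n sh n<|a| 1≤x tab r 1≤r r≤k 1≤fr corner T≡h =
  ⊴-inner⇒⊴ strip′ c⊴ρ , ⊴-inner⇒insertDesc-⊴ (decRow-shape sh corner) strip′ size′ c⊴ρ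
  where
  open RemoveTop sh tab
  x = ent a (suc n)
  c⊴ρ = tableau⇒⊴ a n (Shape-inner sh isStrip) (≤-trans (n≤1+n n) n<|a|) tableau
  strip′ = decRow-strip isStrip (top-outside r 1≤r r≤k 1≤fr T≡h)
  size′ : sumTo k inner + (x ∸ 1) ≡ sumTo k (decRow f r)
  size′ = +-cancelʳ-≡ 1 _ _ (begin
    sumTo k inner + (x ∸ 1) + 1 ≡⟨ +-assoc (sumTo k inner) (x ∸ 1) 1 ⟩
    sumTo k inner + (x ∸ 1 + 1) ≡⟨ cong (sumTo k inner +_) (m∸n+n≡m 1≤x) ⟩
    sumTo k inner + x           ≡⟨ size ⟩
    sumTo k f                   ≡⟨ sumTo-decRow-≥ f r 1≤r 1≤fr r≤k ⟨
    sumTo k (decRow f r) + 1    ∎)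
    where open ≡-Reasoning

stepAt : ℕ → ℕ → ℕ
stepAt r j with r ≤? j
... | yes _ = 1
... | no  _ = 0

stepAt-mono : ∀ r j → stepAt r j ≤ stepAt r (suc j)
stepAt-mono r j with r ≤? j | r ≤? suc j
... | yes _   | yes _     = ≤-refl
... | yes r≤j | no  r≰j+1 = contradiction (m≤n⇒m≤1+n r≤j) r≰j+1
... | no  _   | _         = z≤n

stepAt-≤1 : ∀ r j → stepAt r j ≤ 1
stepAt-≤1 r j with r ≤? j
... | yes _ = ≤-refl
... | no  _ = z≤n

stepAt-flat : ∀ r j → suc j ≢ r → stepAt r (suc j) ≤ stepAt r j
stepAt-flat r j j+1≢r with r ≤? suc j | r ≤? j
... | yes _     | yes _   = ≤-refl
... | yes r≤j+1 | no  r≰j = contradiction (sym (≤-antisym r≤j+1 (≰⇒> r≰j))) j+1≢r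
... | no  _     | _       = z≤n

stepAt-rises : ∀ r → stepAt (suc r) r < stepAt (suc r) (suc r)
stepAt-rises r with suc r ≤? r | suc r ≤? suc r
... | yes r<r | _       = contradiction r<r (n≮n r)
... | no  _   | yes _   = s≤s z≤n
... | no  _   | no  r≰r = contradiction ≤-refl r≰r

⊴⇒corner-tableau : ∀ {k f} a n → Shape k f → suc n ≤ length a → 1 ≤ ent a (suc n) →
  sumTo k f ≡ sumTo (suc n) (ent a) → ∀ r → 1 ≤ r → 1 ≤ f r → f (suc r) < f r →
  insertDesc (ent a (suc n)) (sortDesc (take n a)) ⊴ f → sortDesc (take n a) ⊴ decRow f r →
  ∃ λ T → Tableau k f (suc n) (ent a) T × T r (f r) ≡ suc n
⊴⇒corner-tableau {f = f} a n sh n<|a| 1≤x |f|≡|a| (suc r) 1≤r 1≤fr corner x∷c⊴f c⊴f′ =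
  fillStrip T ρ n , FillStrip.tableau isStrip tab size , fillStrip-outer T ρ n (suc r) (f (suc r)) ρ<f
  where
  x = ent a (suc n)
  c = sortDesc (take n a)
  -- At least one strip cell in the first j rows once j ≥ r forces one into row r.
  e = stepAt (suc r)
  e-step : ∀ j → e (suc j) ≤ e j + (f (suc j) ∸ f (suc (suc j)))
  e-step j with suc j ≟ suc r
  ... | yes refl = ≤-trans (stepAt-≤1 (suc r) (suc j)) (≤-trans (m<n⇒0<n∸m corner) (m≤n+m _ _))
  ... | no j≢r   = ≤-trans (stepAt-flat (suc r) j j≢r) (m≤m+n _ _)
  e≤x : ∀ j → e j ≤ x
  e≤x j = ≤-trans (stepAt-≤1 (suc r) j) 1≤x
  c+e≤f : ∀ j → sum (take j c) + e j ≤ sumTo j f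
  c+e≤f j with suc r ≤? j
  ... | yes r≤j = ≤-trans (+-monoˡ-≤ 1 (c⊴f′ j)) (≤-reflexive (sumTo-decRow-≥ f (suc r) 1≤r 1≤fr r≤j))
  ... | no  _   = insertDesc-⊴⇒⊴ (sortDesc-nonIncr (take n a)) x∷c⊴f j
  open ChooseStrip sh x c e refl (stepAt-mono (suc r)) e-step e≤x c+e≤f (insertDesc-⊴⇒+ x∷c⊴f)
    renaming (inner to ρ)
  ρ<f : ρ (suc r) < f (suc r)
  ρ<f = shrinks r (stepAt-rises r)
  T-tab = ⊴⇒tableau a n (Shape-inner sh isStrip) (≤-trans (n≤1+n n) n<|a|) dominated
                    (+-cancelʳ-≡ x _ _ (trans size |f|≡|a|))
  T = proj₁ T-tab
  tab = proj₂ T-tab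

tildeC-cons : ∀ x y l → tildeC (x ∷ y ∷ l) ≡ x ∷ tildeC (y ∷ l)
tildeC-cons zero          y l = refl
tildeC-cons (suc zero)    y l = refl
tildeC-cons (suc (suc x)) y l = refl

tildeC-snoc-1 : ∀ l → tildeC (l ++ 1 ∷ []) ≡ l
tildeC-snoc-1 []          = refl
tildeC-snoc-1 (x ∷ [])    = tildeC-cons x 1 []
tildeC-snoc-1 (x ∷ y ∷ l) = trans (tildeC-cons x y (l ++ 1 ∷ [])) (cong (x ∷_) (tildeC-snoc-1 (y ∷ l)))

tildeC-snoc-suc : ∀ l z → tildeC (l ++ suc (suc z) ∷ []) ≡ l ++ suc z ∷ []
tildeC-snoc-suc []          z = refl
tildeC-snoc-suc (x ∷ [])    z = tildeC-cons x _ []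
tildeC-snoc-suc (x ∷ y ∷ l) z = trans (tildeC-cons x y _) (cong (x ∷_) (tildeC-snoc-suc (y ∷ l) z))

tildeC-sum : ∀ l → AllPos l → 1 ≤ length l → sum (tildeC l) + 1 ≡ sum l
tildeC-sum (suc zero ∷ [])     _         _ = refl
tildeC-sum (suc (suc x) ∷ [])  _         _ = cong suc (+-comm (x + 0) 1)
tildeC-sum (x ∷ y ∷ l)         (_ ∷ l⁺) _ rewrite tildeC-cons x y l =
  trans (+-assoc x _ 1) (cong (x +_) (tildeC-sum (y ∷ l) l⁺ (s≤s z≤n)))

⊴⇒tildeC-⊴ : ∀ l y {g} → 1 ≤ y → sortDesc l ⊴ g → insertDesc (y ∸ 1) (sortDesc l) ⊴ g →
             sortDesc (tildeC (l ++ y ∷ [])) ⊴ g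
⊴⇒tildeC-⊴ l (suc zero)    _ l⊴g _ rewrite tildeC-snoc-1 l = l⊴g
⊴⇒tildeC-⊴ l (suc (suc z)) _ _ z∷l⊴g rewrite tildeC-snoc-suc l z | sortDesc-snoc l (suc z) = z∷l⊴g

tildeC-⊴⇒⊴ : ∀ l y {g} → 1 ≤ y → sortDesc (tildeC (l ++ y ∷ [])) ⊴ g → sortDesc l ⊴ g
tildeC-⊴⇒⊴ l (suc zero)    _ l⊴g rewrite tildeC-snoc-1 l = l⊴g
tildeC-⊴⇒⊴ l (suc (suc z)) _ z∷l⊴g rewrite tildeC-snoc-suc l z | sortDesc-snoc l (suc z) =
  λ j → ≤-trans (sum-take-insertDesc-mono j (suc z) (sortDesc l) (sortDesc-nonIncr l)) (z∷l⊴g j)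

corner-tableau⇔ : ∀ {k f} a → Shape k f → AllPos a → 1 ≤ length a → sumTo k f ≡ sum a → sortDesc a ⊴ f →
  ∀ r → 1 ≤ r → r ≤ k → 1 ≤ f r →
  (∃ λ T → Tableau k f (length a) (ent a) T × T r (f r) ≡ length a) ⇔ (f (suc r) < f r × sortDesc (tildeC a) ⊴ decRow f r)
corner-tableau⇔ {k} {f} a sh a⁺ 1≤|a| |f|≡|a| a⊴f r 1≤r r≤k 1≤fr with length a in |a|≡ | 1≤|a|
... | suc n | _ = mk⇔ to from
  where
  x = ent a (suc n)
  c = sortDesc (take n a)
  n<|a| = ≤-reflexive (sym |a|≡)
  1≤x = ent-positive a (suc n) a⁺ (s≤s z≤n) n<|a|
  a≡a′++x : a ≡ take n a ++ x ∷ []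
  a≡a′++x = trans (sym (take-all (suc n) a (≤-reflexive |a|≡))) (take-suc≡snoc n a n<|a|)
  x∷c⊴f : insertDesc x c ⊴ f
  x∷c⊴f = subst (_⊴ f) (trans (cong sortDesc a≡a′++x) (sortDesc-snoc (take n a) x)) a⊴f
  |f|≡|a|′ = trans |f|≡|a| (sum≡sumTo-ent a (suc n) (≤-reflexive |a|≡))

  tilde⊴ : List ℕ → Set
  tilde⊴ a′ = sortDesc (tildeC a′) ⊴ decRow f r

  to : (∃ λ T → Tableau k f (suc n) (ent a) T × T r (f r) ≡ suc n) → f (suc r) < f r × tilde⊴ a
  to (T , tab , T≡h) =
    let corner      = maxEntry-corner sh tab r 1≤r r≤k 1≤fr T≡h
        c⊴ , x-1∷c⊴ = corner-tableau⇒⊴ a n sh n<|a| 1≤x tab r 1≤r r≤k 1≤fr corner T≡h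
    in  corner , subst tilde⊴ (sym a≡a′++x) (⊴⇒tildeC-⊴ (take n a) x 1≤x c⊴ x-1∷c⊴)

  from : f (suc r) < f r × tilde⊴ a → ∃ λ T → Tableau k f (suc n) (ent a) T × T r (f r) ≡ suc n
  from (corner , ã⊴) = ⊴⇒corner-tableau a n sh n<|a| 1≤x |f|≡|a|′ r 1≤r 1≤fr corner x∷c⊴f
    (tildeC-⊴⇒⊴ (take n a) x 1≤x (subst tilde⊴ a≡a′++x ã⊴))

ent-shape : ∀ {μ} → NonIncr μ → Shape (length μ) (ent μ)
ent-shape {μ} μ↓ = record { nonIncr = ent-nonIncr μ↓ ; vanish = ent-beyond μ }

IsSTab⇔Tableau : ∀ {μ a T} → IsSTab μ a T ⇔ Tableau (length μ) (ent μ) (length a) (ent a) T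
IsSTab⇔Tableau = mk⇔
  (λ T∈STab → record { range = IsSTab.range T∈STab ; rowWk = IsSTab.rowWk T∈STab
                      ; colStr = IsSTab.colStr T∈STab ; counts = IsSTab.counts T∈STab })
  (λ tab → record { range = Tableau.range tab ; rowWk = Tableau.rowWk tab
                  ; colStr = Tableau.colStr tab ; counts = Tableau.counts tab })

LastPositive : List ℕ → Set
LastPositive l = 1 ≤ length l → 1 ≤ ent l (length l)

⊵⇒⊴ : ∀ p s → p ⊵ s → sum p ≡ sum s → s ⊴ ent p
⊵⇒⊴ p s _                 _       zero    = z≤n
⊵⇒⊴ p s (_ , prefix-≤) |p|≡|s| (suc j) with suc j ≤? length p
... | yes j<|p| = ≤-trans (prefix-≤ (suc j) (s≤s z≤n) j<|p|) (≤-reflexive (sum-take≡sumTo-ent (suc j) p))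
... | no  j≮|p| = ≤-trans (sum-take≤sum (suc j) s)
                    (≤-reflexive (trans (sym |p|≡|s|) (sum≡sumTo-ent p (suc j) (<⇒≤ (≰⇒> j≮|p|)))))

⊴⇒length≤ : ∀ p s → LastPositive p → sum p ≡ sum s → s ⊴ ent p → length p ≤ length s
⊴⇒length≤ []          s _  _       _   = z≤n
⊴⇒length≤ p@(y ∷ p′) s p⁺ |p|≡|s| s⊴p with length p ≤? length s
... | yes |p|≤|s| = |p|≤|s|
... | no  |p|≰|s| = ⊥-elim (<-irrefl refl (begin-strict
  sum p                     ≡⟨ |p|≡|s| ⟩
  sum s                     ≡⟨ cong sum (take-all (length s) s ≤-refl) ⟨
  sum (take (length s) s)   ≤⟨ s⊴p (length s) ⟩
  sumTo (length s) (ent p)  ≤⟨ sumTo-monoˡ (ent p) (≤-pred (≰⇒> |p|≰|s|)) ⟩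
  sumTo (length p′) (ent p) <⟨ m<m+n _ (p⁺ (s≤s z≤n)) ⟩
  sumTo (length p) (ent p)  ≡⟨ sum≡sumTo-ent p (length p) ≤-refl ⟨
  sum p                     ∎))
  where open ≤-Reasoning

⊴⇒⊵ : ∀ p s → LastPositive p → sum p ≡ sum s → s ⊴ ent p → p ⊵ s
⊴⇒⊵ p s p⁺ |p|≡|s| s⊴p =
  ⊴⇒length≤ p s p⁺ |p|≡|s| s⊴p , λ j _ _ → ≤-trans (s⊴p j) (≤-reflexive (sym (sum-take≡sumTo-ent j p)))

indic-suc : ∀ x v → indic (suc x) (suc v) ≡ indic x v
indic-suc x v with x ≟ v
... | yes refl = indic-refl (suc x)
... | no  x≢v  = indic-≢ (λ x+1≡v+1 → x≢v (suc-injective x+1≡v+1))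

ent-decAt : ∀ l r i → ent (decAt l r) i ≡ decRow (ent l) r i
ent-decAt []      r             i             = sym (0∸n≡0 (indic i r))
ent-decAt (x ∷ l) zero          zero          = refl
ent-decAt (x ∷ l) zero          (suc zero)    = refl
ent-decAt (x ∷ l) zero          (suc (suc i)) = refl
ent-decAt (x ∷ l) (suc zero)    zero          = refl
ent-decAt (x ∷ l) (suc zero)    (suc zero)    = refl
ent-decAt (x ∷ l) (suc zero)    (suc (suc i)) = refl
ent-decAt (x ∷ l) (suc (suc r)) zero          = refl
ent-decAt (x ∷ l) (suc (suc r)) (suc zero)    = refl
ent-decAt (x ∷ l) (suc (suc r)) (suc (suc i)) =
  trans (ent-decAt l (suc r) (suc i)) (cong (ent l (suc i) ∸_) (sym (indic-suc (suc i) (suc r))))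

length-decAt : ∀ l r → length (decAt l r) ≡ length l
length-decAt []      r             = refl
length-decAt (x ∷ l) zero          = refl
length-decAt (x ∷ l) (suc zero)    = refl
length-decAt (x ∷ l) (suc (suc r)) = cong suc (length-decAt l (suc r))

ent-cons-cong : ∀ x {l l′} → (∀ i → ent l i ≡ ent l′ i) → ∀ i → ent (x ∷ l) i ≡ ent (x ∷ l′) i
ent-cons-cong x l≗l′ zero          = refl
ent-cons-cong x l≗l′ (suc zero)    = refl
ent-cons-cong x l≗l′ (suc (suc i)) = l≗l′ (suc i)

ent-consNZ : ∀ x l i → ent (consNZ x l) i ≡ ent (x ∷ l) i
ent-consNZ zero    []      zero          = refl
ent-consNZ zero    []      (suc zero)    = refl
ent-consNZ zero    []      (suc (suc i)) = refl
ent-consNZ (suc x) []      i             = refl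
ent-consNZ zero    (y ∷ l) i             = refl
ent-consNZ (suc x) (y ∷ l) i             = refl

ent-stripZeros : ∀ l i → ent (stripZeros l) i ≡ ent l i
ent-stripZeros []      i = refl
ent-stripZeros (x ∷ l) i = trans (ent-consNZ x (stripZeros l) i) (ent-cons-cong x (ent-stripZeros l) i)

length-consNZ : ∀ x l → length (consNZ x l) ≤ suc (length l)
length-consNZ zero    []      = z≤n
length-consNZ (suc x) []      = ≤-refl
length-consNZ zero    (y ∷ l) = ≤-refl
length-consNZ (suc x) (y ∷ l) = ≤-refl

length-stripZeros : ∀ l → length (stripZeros l) ≤ length l
length-stripZeros []      = z≤n
length-stripZeros (x ∷ l) = ≤-trans (length-consNZ x (stripZeros l)) (s≤s (length-stripZeros l))

consNZ-lastPositive : ∀ x l → LastPositive l → LastPositive (consNZ x l)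
consNZ-lastPositive zero    []      _  ()
consNZ-lastPositive (suc x) []      _  _ = s≤s z≤n
consNZ-lastPositive zero    (y ∷ l) l⁺ _ = l⁺ (s≤s z≤n)
consNZ-lastPositive (suc x) (y ∷ l) l⁺ _ = l⁺ (s≤s z≤n)

stripZeros-lastPositive : ∀ l → LastPositive (stripZeros l)
stripZeros-lastPositive []      ()
stripZeros-lastPositive (x ∷ l) = consNZ-lastPositive x (stripZeros l) (stripZeros-lastPositive l)

ent-μdec : ∀ μ r i → ent (μdec μ r) i ≡ decRow (ent μ) r i
ent-μdec μ r i = trans (ent-stripZeros (decAt μ r) i) (ent-decAt μ r i)

μdec-⊵⇔ : ∀ μ r s → sum (μdec μ r) ≡ sum s → (μdec μ r ⊵ s) ⇔ (s ⊴ decRow (ent μ) r)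
μdec-⊵⇔ μ r s |μ′|≡|s| = mk⇔
  (λ μ′⊵s → ⊴-cong (⊵⇒⊴ (μdec μ r) s μ′⊵s |μ′|≡|s|) (ent-μdec μ r))
  (λ s⊴ → ⊴⇒⊵ (μdec μ r) s (stripZeros-lastPositive (decAt μ r)) |μ′|≡|s| (⊴-cong s⊴ (λ i → sym (ent-μdec μ r i))))

sum-μdec : ∀ μ r → AllPos μ → 1 ≤ r → r ≤ length μ → sum (μdec μ r) + 1 ≡ sum μ
sum-μdec μ r μ⁺ 1≤r r≤k = begin
  sum (μdec μ r) + 1                      ≡⟨ cong (_+ 1) (sum≡sumTo-ent (μdec μ r) (length μ) |μ′|≤|μ|) ⟩
  sumTo (length μ) (ent (μdec μ r)) + 1   ≡⟨ cong (_+ 1) (sumTo-cong (length μ) (λ i _ _ → ent-μdec μ r i)) ⟩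
  sumTo (length μ) (decRow (ent μ) r) + 1 ≡⟨ sumTo-decRow-≥ (ent μ) r 1≤r (ent-positive μ r μ⁺ 1≤r r≤k) r≤k ⟩
  sumTo (length μ) (ent μ)                ≡⟨ sum≡sumTo-ent μ (length μ) ≤-refl ⟨
  sum μ                                   ∎
  where
  open ≡-Reasoning
  |μ′|≤|μ| = ≤-trans (length-stripZeros (decAt μ r)) (≤-reflexive (length-decAt μ r))

proposition4p6 : (μ a : List ℕ) → IsPartition μ → IsComposition a → sum μ ≡ sum a
               → μ ⊵ sortDesc a → (r : ℕ) → 1 ≤ r → r ≤ length μ
               → (∃ λ (T : ℕ → ℕ → ℕ) → IsSTab μ a T × (T r (ent μ r) ≡ length a)) ⇔ InR μ a r
proposition4p6 μ a (μ⁺ , μ↓) a⁺ |μ|≡|a| μ⊵a r 1≤r r≤k = mk⇔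
  (λ (T , T∈STab , T≡h) →
     let corner , ã⊴ = to (T , Equivalence.to IsSTab⇔Tableau T∈STab , T≡h)
     in 1≤r , r≤k , corner , Equivalence.from μ′⊵ã⇔ ã⊴)
  (λ (_ , _ , corner , μ′⊵ã) →
     let T , tab , T≡h = from (corner , Equivalence.to μ′⊵ã⇔ μ′⊵ã)
     in T , Equivalence.from IsSTab⇔Tableau tab , T≡h)
  where
  1≤|a| : 1 ≤ length a
  1≤|a| = ≤-trans 1≤r (≤-trans r≤k (≤-trans (proj₁ μ⊵a) (≤-reflexive (sortDesc-length a))))
  |μ′|≡|ã| : sum (μdec μ r) ≡ sum (sortDesc (tildeC a))
  |μ′|≡|ã| = +-cancelʳ-≡ 1 _ _ (trans (sum-μdec μ r μ⁺ 1≤r r≤k) (trans |μ|≡|a|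
               (sym (trans (cong (_+ 1) (sortDesc-sum (tildeC a))) (tildeC-sum a a⁺ 1≤|a|)))))
  μ′⊵ã⇔ = μdec-⊵⇔ μ r (sortDesc (tildeC a)) |μ′|≡|ã|
  open Equivalence (corner-tableau⇔ a (ent-shape μ↓) a⁺ 1≤|a|
    (trans (sym (sum≡sumTo-ent μ (length μ) ≤-refl)) |μ|≡|a|)
    (⊵⇒⊴ μ (sortDesc a) μ⊵a (trans |μ|≡|a| (sym (sortDesc-sum a)))) r 1≤r r≤k (ent-positive μ r μ⁺ 1≤r r≤k))
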